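{- Let $n,m\geq1$, $\pi\in Y_n$ and $\tau\in Y_m$. Then: (1) $\mathrm{name}(\pi\vee\tau)=\mathrm{name}(\pi)\vee\mathrm{name}(\tau)$, where for $\vec{v}\in\mathbb{N}^n$, $\vec{w}\in\mathbb{N}^m$ we set $\vec{v}\vee\vec{w}:=(v_1,\ldots,v_n,1,w_1+n+1,\ldots,w_m+n+1)$. (2) $M(\mathrm{name}(\pi\vee\tau))=(-1)^m M(\mathrm{name}(\pi))$ if $\mathrm{name}(\tau)=(1,2,\ldots,m)$, and $M(\mathrm{name}(\pi\vee\tau))=0$ otherwise. (3) For all $\vec{v},\vec{w}\in\widehat{\mathbb{N}}^n$ and $\vec{u},\vec{z}\in\widehat{\mathbb{N}}^m$: ($\vec{v}\leq\vec{w}$ and $\vec{u}<\vec{z}$) or ($\vec{v}<\vec{w}$ and $\vec{u}\leq\vec{z}$) holds if and only if $\vec{v}\vee\vec{u}<\vec{w}\vee\vec{z}$.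
   Context: $Y_n$ is the set of planar rooted binary trees with $n$ internal vertices ($n+1$ leaves), identified with complete parenthesizations of $x_1\cdots x_{n+1}$ (each product of two factors $A,B$ written $(AB)$). The grafting $\pi\vee\tau\in Y_{n+m+1}$ is the tree obtained by identifying the root of $\pi$ with the left leaf and the root of $\tau$ with the right leaf of the one-vertex tree; its parenthesization is $(E_\pi E_\tau')$ where $E_\pi$ is that of $\pi$ and $E_\tau'$ is that of $\tau$ with each $x_k$ renamed $x_{k+n+1}$. The name of $\tau\in Y_n$ is $\mathrm{name}(\tau)=(v_1,\ldots,v_n)\in\mathbb{N}^n$ defined from its parenthesization: $v_i=i$ if $x_i$ is immediately preceded by at least one left parenthesis; otherwise $x_i$ is immediately followed by a nonempty block of right parentheses and $v_i=j$, where $x_j$ is the first variable after the left parenthesis matched with the last right parenthesis of that block. $\widehat{\mathbb{N}}^n$ denotes the set of names of trees in $Y_n$; $\mathrm{name}:Y_n\to\widehat{\mathbb{N}}^n$ is a bijection. $\widehat{\mathbb{N}}^n$ is ordered componentwise ($\vec v\le\vec w$ iff $v_i\le w_i$ for all $i$); $<$ means $\leq$ and $\neq$. Its minimum is $(1,1,\ldots,1)$, and $M(\vec v):=\mu((1,\ldots,1),\vec v)$, where $\mu$ is the Möbius function of the poset $(\widehat{\mathbb{N}}^n,\le)$. -}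

module Defs where

open import Data.Nat using (ℕ; zero; suc; _+_; _≤_; _≟_; _≤?_)
open import Data.Integer using (ℤ; 0ℤ; 1ℤ; -_) renaming (_+_ to _+ℤ_)
open import Data.List using (List; []; _∷_; _++_; [_]; map; filter; length; applyUpTo; replicate; deduplicate; cartesianProductWith)
open import Data.List.Properties using (≡-dec)
open import Data.List.Relation.Binary.Pointwise using (Pointwise)
import Data.List.Relation.Binary.Pointwise.Properties as PW
open import Data.Product using (Σ; ∃; _×_; _,_)
open import Relation.Nullary using (¬_; Dec; yes; no; ¬?)
open import Relation.Nullary.Decidable using (_×-dec_)
open import Relation.Binary.PropositionalEquality using (_≡_)
open import Relation.Binary using (DecidableEquality)

data Tree : Set where
  leaf : Tree
  node : Tree → Tree → Tree

size : Tree → ℕ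
size leaf       = 0
size (node l r) = suc (size l + size r)

Y : ℕ → Tree → Set
Y n t = size t ≡ n

graft : Tree → Tree → Tree
graft π τ = node π τ

data Tok : Set where
  lp rp : Tok
  var   : ℕ → Tok

-- paren t k : parenthesization of t with variables x_{k+1}, x_{k+2}, ...
paren : Tree → ℕ → List Tok
paren leaf       k = [ var (suc k) ]
paren (node l r) k = lp ∷ (paren l k ++ (paren r (k + suc (size l)) ++ [ rp ]))

-- split i ts acc = (reversed prefix before the first occurrence of x_i,
--                   suffix after it)
split : ℕ → List Tok → List Tok → List Tok × List Tok
split i []             acc = acc , []
split i (lp ∷ ts)      acc = split i ts (lp ∷ acc)
split i (rp ∷ ts)      acc = split i ts (rp ∷ acc)
split i (var j ∷ ts)   acc with i ≟ j
... | yes _ = acc , ts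
... | no  _ = split i ts (var j ∷ acc)

rpBlock : List Tok → ℕ
rpBlock (rp ∷ ts) = suc (rpBlock ts)
rpBlock _         = 0

-- Scan a reversed token list (the tokens strictly before some right
-- parenthesis, read right-to-left) until the left parenthesis matching
-- that right parenthesis; return the first variable after that left
-- parenthesis (= the last variable seen during the backwards scan).
matchVar : ℕ → ℕ → List Tok → ℕ
matchVar d       v []          = 0
matchVar d       v (var j ∷ ts) = matchVar d j ts
matchVar d       v (rp ∷ ts)   = matchVar (suc d) v ts
matchVar zero    v (lp ∷ ts)   = v
matchVar (suc d) v (lp ∷ ts)   = matchVar d v ts

nameAt : List Tok → ℕ → ℕ
nameAt ts i with split i ts []
... | lp ∷ _ , post = i
... | pre    , post with rpBlock post
...   | zero  = 0
...   | suc k = matchVar 0 0 (replicate k rp ++ (var i ∷ pre))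

name : Tree → List ℕ
name t = applyUpTo (λ i → nameAt (paren t 0) (suc i)) (size t)

_∨ᵥ_ : List ℕ → List ℕ → List ℕ
v ∨ᵥ w = v ++ (1 ∷ map (λ x → x + length v + 1) w)

idName : ℕ → List ℕ
idName m = applyUpTo suc m

IsName : ℕ → List ℕ → Set
IsName n v = ∃ λ t → Y n t × name t ≡ v

_≤ᵥ_ : List ℕ → List ℕ → Set
v ≤ᵥ w = Pointwise _≤_ v w

_<ᵥ_ : List ℕ → List ℕ → Set
v <ᵥ w = v ≤ᵥ w × ¬ (v ≡ w)

_≟ᵥ_ : DecidableEquality (List ℕ)
_≟ᵥ_ = ≡-dec _≟_

_≤ᵥ?_ : (v w : List ℕ) → Dec (v ≤ᵥ w)
_≤ᵥ?_ = PW.decidable _≤?_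

_<ᵥ?_ : (v w : List ℕ) → Dec (v <ᵥ w)
v <ᵥ? w = (v ≤ᵥ? w) ×-dec ¬? (v ≟ᵥ w)

treesH : ℕ → List Tree
treesH zero    = [ leaf ]
treesH (suc k) = leaf ∷ cartesianProductWith node (treesH k) (treesH k)

-- a list containing every tree of Y_n (a tree with n internal vertices
-- has height ≤ n)
allTrees : ℕ → List Tree
allTrees n = filter (λ t → size t ≟ n) (treesH n)

-- the finite set N̂^n, as a repetition-free list
names : ℕ → List (List ℕ)
names n = deduplicate _≟ᵥ_ (map name (allTrees n))

-- Möbius function of the poset (names n, ≤ᵥ):
-- μ(x,x) = 1,  μ(x,y) = - Σ_{x ≤ z < y} μ(x,z).
-- The fuel argument bounds the length of strict chains; fuel = number
-- of elements suffices.

sumℤ : List ℤ → ℤ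
sumℤ []       = 0ℤ
sumℤ (x ∷ xs) = x +ℤ sumℤ xs

mobF : ℕ → List (List ℕ) → List ℕ → List ℕ → ℤ
mobF zero    es x y = 0ℤ
mobF (suc f) es x y with x ≟ᵥ y
... | yes _ = 1ℤ
... | no  _ = - sumℤ (map (mobF f es x)
                         (filter (λ z → (x ≤ᵥ? z) ×-dec (z <ᵥ? y)) es))

μ : ℕ → List ℕ → List ℕ → ℤ
μ n x y = mobF (length (names n)) (names n) x y

M : ℕ → List ℕ → ℤ
M n v = μ n (replicate n 1) v

-- Each entry of a name is determined inside the smallest subterm containing the variable and the
-- block of right parentheses after it.  Hence the entries of name (π ∨ τ) at the variables of π and
-- of τ are those of name π and of name τ, the latter shifted by n + 1, while x_{n+1}, which closes π,
-- gets the entry 1.  This is (1); (3) follows because the shift is an order embedding once the left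
-- parts have equal length.
--
-- For (2), M v is the product over the positions i of cᵢ, where cᵢ = 1 if vᵢ = 1, cᵢ = −1 if
-- vᵢ = i ≥ 2, and cᵢ = 0 otherwise.  It suffices that this product satisfies the defining recursion
-- of μ, i.e. that its sum over the names z ≤ y vanishes for every name y ≠ (1,…,1).  The product is
-- supported on the vectors with zᵢ ∈ {1, i}, all of which are names; summed over those below y it
-- factorises as ∏_{i ≥ 2} ([1 ≤ yᵢ] − [i ≤ yᵢ]), and a name y ≠ (1,…,1) has an entry yᵢ ≥ i ≥ 2.
-- The product is multiplicative under concatenation, and the shifted entries of name τ are never 1,
-- so the factor contributed by τ is (−1)^m if name τ = (1,…,m) and 0 otherwise.
{-# OPTIONS --safe #-}
module Submission where

open import Defs
open import Data.Bool using (true; false; if_then_else_)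
open import Data.Empty using (⊥)
open import Data.Integer using (ℤ; 0ℤ; 1ℤ; -1ℤ; -_; _*_; _^_) renaming (_+_ to _+ℤ_; _≟_ to _≟ℤ_)
import Data.Integer.Properties as ℤ
open import Algebra.Properties.CommutativeSemigroup ℤ.+-commutativeSemigroup using (interchange; x∙yz≈y∙xz)
open import Data.List using (List; []; _∷_; _++_; [_]; _ʳ++_; map; filter; length; applyUpTo; replicate; iterate)
open import Data.List.Properties
  using (++-assoc; ++-ʳ++; ++-identityʳ; length-applyUpTo; map-cong; map-++; map-∘; ∷-injectiveʳ; ∷-injectiveˡ;
         filter-accept; filter-reject; filter-all; filter-notAll)
open import Data.List.Membership.Propositional using (_∈_; _∉_; lose)
open import Data.List.Membership.Propositional.Properties
  using (∈-map⁺; ∈-map⁻; ∈-++⁺ˡ; ∈-++⁺ʳ; ∈-++⁻; ∈-filter⁺; ∈-filter⁻; ∈-deduplicate⁺; ∈-deduplicate⁻;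
         ∈-cartesianProductWith⁺)
open import Data.List.Relation.Binary.Pointwise as Pointwise using (Pointwise; []; _∷_; Pointwise-≡⇒≡)
open import Data.List.Relation.Unary.All as All using (All; []; _∷_)
open import Data.List.Relation.Unary.All.Properties using (++⁺; map⁺)
open import Data.List.Relation.Unary.AllPairs using ([]; _∷_)
open import Data.List.Relation.Unary.Any using (here; there)
open import Data.List.Relation.Unary.Unique.Propositional using (Unique)
import Data.List.Relation.Unary.Unique.Propositional.Properties as Unique
open import Data.List.Relation.Unary.Unique.DecPropositional.Properties _≟ᵥ_ using (deduplicate-!)
open import Data.Nat using (ℕ; zero; suc; _+_; _≤_; _<_; _≟_; _≤?_; z≤n; s≤s; s≤s⁻¹)
open import Data.Nat.Properties
open import Algebra.Properties.CommutativeSemigroup +-commutativeSemigroup using (xy∙z≈xz∙y)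
open import Data.Product using (∃-syntax; _×_; _,_; proj₁; proj₂)
open import Data.Sum using (_⊎_; inj₁; inj₂)
open import Data.Unit using (⊤; tt)
open import Function using (_∘_)
open import Function.Bundles using (_⇔_; mk⇔)
open import Relation.Binary using (DecidableEquality)
open import Relation.Binary.PropositionalEquality
  using (_≡_; _≢_; refl; sym; trans; cong; cong₂; subst; subst₂; module ≡-Reasoning)
open import Relation.Nullary using (¬_; Dec; does; yes; no; ¬?; contradiction)
open import Relation.Nullary.Decidable using (_×-dec_; dec-true; dec-false)
open import Relation.Unary using (Decidable; _⊆_)

open ≡-Reasoning

applyUpTo-cong : ∀ {A : Set} {f g : ℕ → A} → (∀ i → f i ≡ g i) → ∀ n → applyUpTo f n ≡ applyUpTo g n
applyUpTo-cong f≗g zero    = refl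
applyUpTo-cong f≗g (suc n) = cong₂ _∷_ (f≗g 0) (applyUpTo-cong (λ i → f≗g (suc i)) n)

applyUpTo-+ : ∀ {A : Set} (f : ℕ → A) m n → applyUpTo f (m + n) ≡ applyUpTo f m ++ applyUpTo (λ i → f (m + i)) n
applyUpTo-+ f zero    n = refl
applyUpTo-+ f (suc m) n = cong (f 0 ∷_) (applyUpTo-+ (λ i → f (suc i)) m n)

applyUpTo-iterate : ∀ (f : ℕ → ℕ) m → (∀ i → f (suc i) ≡ suc (f i)) → applyUpTo f m ≡ iterate suc (f 0) m
applyUpTo-iterate f zero    _     = refl
applyUpTo-iterate f (suc m) f-suc = cong (f 0 ∷_) (begin
  applyUpTo (λ i → f (suc i)) m ≡⟨ applyUpTo-iterate (λ i → f (suc i)) m (λ i → f-suc (suc i)) ⟩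
  iterate suc (f 1) m           ≡⟨ cong (λ j → iterate suc j m) (f-suc 0) ⟩
  iterate suc (suc (f 0)) m     ∎)

replicate-++-∷ : ∀ {A : Set} n (x : A) ys → replicate n x ++ x ∷ ys ≡ x ∷ replicate n x ++ ys
replicate-++-∷ zero    x ys = refl
replicate-++-∷ (suc n) x ys = cong (x ∷_) (replicate-++-∷ n x ys)

filter-filter-⊆ : ∀ {A : Set} {P Q : A → Set} (P? : Decidable P) (Q? : Decidable Q) → P ⊆ Q →
                  ∀ xs → filter P? (filter Q? xs) ≡ filter P? xs
filter-filter-⊆ P? Q? P⊆Q []       = refl
filter-filter-⊆ P? Q? P⊆Q (x ∷ xs) with Q? x
... | no ¬Qx = trans (filter-filter-⊆ P? Q? P⊆Q xs) (sym (filter-reject P? (¬Qx ∘ P⊆Q)))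
... | yes _ with P? x
...   | yes _ = cong (x ∷_) (filter-filter-⊆ P? Q? P⊆Q xs)
...   | no  _ = filter-filter-⊆ P? Q? P⊆Q xs

Pointwise-++⁻ : ∀ {A : Set} {R : A → A → Set} {a b c d : List A} → length a ≡ length b →
                Pointwise R (a ++ c) (b ++ d) → Pointwise R a b × Pointwise R c d
Pointwise-++⁻ {a = []}    {[]}    _    rs       = [] , rs
Pointwise-++⁻ {a = _ ∷ a} {_ ∷ b} len≡ (r ∷ rs) with Pointwise-++⁻ {a = a} {b} (suc-injective len≡) rs
... | rs₁ , rs₂ = r ∷ rs₁ , rs₂

-- Reading a name off the parenthesization

lastVar : Tree → ℕ → ℕ
lastVar t k = k + suc (size t)

lastVar-left : ∀ l r k → lastVar l k < lastVar (node l r) k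
lastVar-left l r k = +-monoʳ-< k (s≤s (s≤s (m≤m+n (size l) (size r))))

lastVar-right : ∀ l r k → lastVar r (lastVar l k) ≡ lastVar (node l r) k
lastVar-right l r k = trans (+-assoc k (suc (size l)) (suc (size r))) (cong (λ n → k + suc n) (+-suc (size l) (size r)))

Below : ℕ → Tok → Set
Below i (var j) = j < i
Below i _       = ⊤

split-hit : ∀ i ts acc → split i (var i ∷ ts) acc ≡ (acc , ts)
split-hit i ts acc with i ≟ i
... | yes _  = refl
... | no i≢i = contradiction refl i≢i

split-++ : ∀ {i} xs {ys acc} → All (Below i) xs → split i (xs ++ ys) acc ≡ split i ys (xs ʳ++ acc)
split-++ []        []          = refl
split-++ (lp ∷ xs) (_ ∷ below) = split-++ xs below
split-++ (rp ∷ xs) (_ ∷ below) = split-++ xs below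
split-++ {i} (var j ∷ xs) (j<i ∷ below) with i ≟ j
... | yes refl = contradiction j<i (<-irrefl refl)
... | no _     = split-++ xs below

paren-node-++ : ∀ l r k D → paren (node l r) k ++ D ≡ lp ∷ paren l k ++ paren r (lastVar l k) ++ rp ∷ D
paren-node-++ l r k D =
  cong (lp ∷_) (trans (++-assoc (paren l k) _ D) (cong (paren l k ++_) (++-assoc (paren r (lastVar l k)) [ rp ] D)))

paren-node-ʳ++ : ∀ l r k Y → paren (node l r) k ʳ++ Y ≡ rp ∷ paren r (lastVar l k) ʳ++ paren l k ʳ++ lp ∷ Y
paren-node-ʳ++ l r k Y = begin
  (paren l k ++ paren r (lastVar l k) ++ [ rp ]) ʳ++ lp ∷ Y  ≡⟨ ++-ʳ++ (paren l k) ⟩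
  (paren r (lastVar l k) ++ [ rp ]) ʳ++ paren l k ʳ++ lp ∷ Y ≡⟨ ++-ʳ++ (paren r (lastVar l k)) ⟩
  rp ∷ paren r (lastVar l k) ʳ++ paren l k ʳ++ lp ∷ Y        ∎

paren-below : ∀ t k {i} → lastVar t k < i → All (Below i) (paren t k)
paren-below leaf       k {i} last<i = subst (_< i) (+-comm k 1) last<i ∷ []
paren-below (node l r) k {i} last<i =
  tt ∷ ++⁺ (paren-below l k (<-trans (lastVar-left l r k) last<i))
           (++⁺ (paren-below r (lastVar l k) (subst (_< i) (sym (lastVar-right l r k)) last<i)) (tt ∷ []))

-- The tokens of paren t k before its last variable.
front : Tree → ℕ → List Tok
front leaf       k = []
front (node l r) k = lp ∷ paren l k ++ front r (lastVar l k)

rightDepth : Tree → ℕ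
rightDepth leaf       = 0
rightDepth (node l r) = suc (rightDepth r)

split-last : ∀ t k D acc →
             split (lastVar t k) (paren t k ++ D) acc ≡ (front t k ʳ++ acc , replicate (rightDepth t) rp ++ D)
split-last leaf       k D acc rewrite +-comm k 1 = split-hit (suc k) D acc
split-last (node l r) k D acc = begin
  split (lastVar (node l r) k) (paren (node l r) k ++ D) acc
    ≡⟨ cong (λ ts → split (lastVar (node l r) k) ts acc) (paren-node-++ l r k D) ⟩
  split (lastVar (node l r) k) (paren l k ++ paren r k′ ++ rp ∷ D) (lp ∷ acc)
    ≡⟨ split-++ (paren l k) (paren-below l k (lastVar-left l r k)) ⟩
  split (lastVar (node l r) k) (paren r k′ ++ rp ∷ D) (paren l k ʳ++ lp ∷ acc)
    ≡⟨ cong (λ i → split i (paren r k′ ++ rp ∷ D) (paren l k ʳ++ lp ∷ acc)) (lastVar-right l r k) ⟨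
  split (lastVar r k′) (paren r k′ ++ rp ∷ D) (paren l k ʳ++ lp ∷ acc)
    ≡⟨ split-last r k′ (rp ∷ D) _ ⟩
  (front r k′ ʳ++ paren l k ʳ++ lp ∷ acc , replicate (rightDepth r) rp ++ rp ∷ D)
    ≡⟨ cong₂ _,_ (sym (++-ʳ++ (paren l k))) (replicate-++-∷ (rightDepth r) rp D) ⟩
  (front (node l r) k ʳ++ acc , replicate (rightDepth (node l r)) rp ++ D) ∎
  where k′ = lastVar l k

matchVar-paren : ∀ t k d v Y → matchVar d v (paren t k ʳ++ Y) ≡ matchVar d (suc k) Y
matchVar-paren leaf       k d v Y = refl
matchVar-paren (node l r) k d v Y rewrite paren-node-ʳ++ l r k Y =
  trans (matchVar-paren r (lastVar l k) (suc d) v _) (matchVar-paren l k (suc d) _ (lp ∷ Y))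

matchVar-last : ∀ t k d v Y →
                matchVar d v (replicate (rightDepth t) rp ++ var (lastVar t k) ∷ front t k ʳ++ Y) ≡ matchVar d (suc k) Y
matchVar-last leaf       k d v Y rewrite +-comm k 1 = refl
matchVar-last (node l r) k d v Y rewrite sym (lastVar-right l r k) | ++-ʳ++ (lp ∷ paren l k) {front r (lastVar l k)} {Y} =
  trans (matchVar-last r (lastVar l k) (suc d) v _) (matchVar-paren l k (suc d) _ (lp ∷ Y))

LpHeaded : List Tok → Set
LpHeaded (lp ∷ _) = ⊤
LpHeaded _        = ⊥

paren-ʳ++-¬LpHeaded : ∀ t k Y → ¬ LpHeaded (paren t k ʳ++ Y)
paren-ʳ++-¬LpHeaded leaf       k Y = λ ()
paren-ʳ++-¬LpHeaded (node l r) k Y rewrite paren-node-ʳ++ l r k Y = λ ()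

front-ʳ++-¬LpHeaded : ∀ l r k Y → ¬ LpHeaded (front (node l r) k ʳ++ Y)
front-ʳ++-¬LpHeaded l r k Y rewrite ++-ʳ++ (lp ∷ paren l k) {front r (lastVar l k)} {Y} with r
... | leaf       = paren-ʳ++-¬LpHeaded l k (lp ∷ Y)
... | node r₁ r₂ = front-ʳ++-¬LpHeaded r₁ r₂ (lastVar l k) (paren l k ʳ++ lp ∷ Y)

closingEntry : ℕ → List Tok → ℕ → ℕ
closingEntry i pre zero    = 0
closingEntry i pre (suc j) = matchVar 0 0 (replicate j rp ++ var i ∷ pre)

readEntry : ℕ → List Tok × List Tok → ℕ
readEntry i (lp ∷ _ , post) = i
readEntry i (pre , post)    = closingEntry i pre (rpBlock post)

nameAt-readEntry : ∀ ts i → nameAt ts i ≡ readEntry i (split i ts [])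
nameAt-readEntry ts i with split i ts []
... | lp ∷ _ , post = refl
... | [] , post with rpBlock post
...   | zero  = refl
...   | suc _ = refl
nameAt-readEntry ts i | rp ∷ _ , post with rpBlock post
...   | zero  = refl
...   | suc _ = refl
nameAt-readEntry ts i | var _ ∷ _ , post with rpBlock post
...   | zero  = refl
...   | suc _ = refl

readEntry-closing : ∀ i pre post → ¬ LpHeaded pre →
                    readEntry i (pre , rp ∷ post) ≡ matchVar 0 0 (replicate (rpBlock post) rp ++ var i ∷ pre)
readEntry-closing i []          post _        = refl
readEntry-closing i (lp ∷ _)    post ¬lp-head = contradiction tt ¬lp-head
readEntry-closing i (rp ∷ _)    post _        = refl
readEntry-closing i (var _ ∷ _) post _        = refl

entryAt : List Tok → List Tok → ℕ → ℕ
entryAt acc ts i = readEntry i (split i ts acc)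

rpBlock-replicate : ∀ n D → rpBlock D ≡ 0 → rpBlock (replicate n rp ++ D) ≡ n
rpBlock-replicate zero    D D-open = D-open
rpBlock-replicate (suc n) D D-open = cong suc (rpBlock-replicate n D D-open)

rpBlock-paren : ∀ t k D → rpBlock (paren t k ++ D) ≡ 0
rpBlock-paren leaf       k D = refl
rpBlock-paren (node l r) k D = refl

-- The right parentheses after the last variable of l = node a b end with the one matching the
-- parenthesis that opens l, whose first variable is x_{k+1}.
entryAt-lastVar : ∀ l k acc D → rpBlock D ≡ 0 → entryAt (lp ∷ acc) (paren l k ++ D) (lastVar l k) ≡ suc k
entryAt-lastVar leaf k acc D _ rewrite split-last leaf k D (lp ∷ acc) = +-comm k 1
entryAt-lastVar l@(node a b) k acc D D-open rewrite split-last l k D (lp ∷ acc) = begin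
  readEntry (lastVar l k) (front l k ʳ++ lp ∷ acc , rp ∷ replicate (rightDepth b) rp ++ D)
    ≡⟨ readEntry-closing _ _ _ (front-ʳ++-¬LpHeaded a b k (lp ∷ acc)) ⟩
  matchVar 0 0 (replicate (rpBlock (replicate (rightDepth b) rp ++ D)) rp ++ var (lastVar l k) ∷ front l k ʳ++ lp ∷ acc)
    ≡⟨ cong (λ n → matchVar 0 0 (replicate n rp ++ _)) (rpBlock-replicate (rightDepth b) D D-open) ⟩
  matchVar 0 0 (replicate (rightDepth b) rp ++ var (lastVar l k) ∷ front l k ʳ++ lp ∷ acc)
    ≡⟨ cong₂ (λ i pre → matchVar 0 0 (replicate (rightDepth b) rp ++ var i ∷ pre))
             (lastVar-right a b k) (sym (++-ʳ++ (lp ∷ paren a k))) ⟨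
  matchVar 0 0 (replicate (rightDepth b) rp ++ var (lastVar b (lastVar a k)) ∷ front b (lastVar a k) ʳ++ paren a k ʳ++ lp ∷ lp ∷ acc)
    ≡⟨ matchVar-last b (lastVar a k) 0 0 _ ⟩
  matchVar 0 (suc (lastVar a k)) (paren a k ʳ++ lp ∷ lp ∷ acc)
    ≡⟨ matchVar-paren a k 0 _ _ ⟩
  suc k ∎

entryAt-skip-left : ∀ l r k acc D i →
  entryAt (lp ∷ acc) (paren l k ++ paren r (lastVar l k) ++ rp ∷ D) (k + suc (size l + suc i))
    ≡ entryAt (paren l k ʳ++ lp ∷ acc) (paren r (lastVar l k) ++ rp ∷ D) (lastVar l k + suc i)
entryAt-skip-left l r k acc D i rewrite sym (+-assoc k (suc (size l)) (suc i)) =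
  cong (readEntry _) (split-++ (paren l k) (paren-below l k (m<m+n (lastVar l k) (s≤s z≤n))))

-- The name of t when its variables are x_{k+1}, x_{k+2}, …
nameFrom : ℕ → Tree → List ℕ
nameFrom k leaf       = []
nameFrom k (node l r) = nameFrom k l ++ suc k ∷ nameFrom (lastVar l k) r

entryAt-paren : ∀ t k acc D → applyUpTo (λ i → entryAt acc (paren t k ++ D) (k + suc i)) (size t) ≡ nameFrom k t
entryAt-paren leaf       k acc D = refl
entryAt-paren (node l r) k acc D = begin
  applyUpTo (λ i → entryAt acc (paren (node l r) k ++ D) (k + suc i)) (size (node l r))
    ≡⟨ cong (λ ts → applyUpTo (λ i → entryAt acc ts (k + suc i)) (size (node l r))) (paren-node-++ l r k D) ⟩
  applyUpTo E (suc (size l + size r))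
    ≡⟨ cong (applyUpTo E) (+-suc (size l) (size r)) ⟨
  applyUpTo E (size l + suc (size r))
    ≡⟨ applyUpTo-+ E (size l) (suc (size r)) ⟩
  applyUpTo E (size l) ++ E (size l + 0) ∷ applyUpTo (λ i → E (size l + suc i)) (size r)
    ≡⟨ cong₂ _++_ (entryAt-paren l k (lp ∷ acc) D′) (cong₂ _∷_ middle right) ⟩
  nameFrom k l ++ suc k ∷ nameFrom (lastVar l k) r ∎
  where
  D′ = paren r (lastVar l k) ++ rp ∷ D
  E : ℕ → ℕ
  E i = entryAt (lp ∷ acc) (paren l k ++ D′) (k + suc i)
  middle : E (size l + 0) ≡ suc k
  middle rewrite +-identityʳ (size l) = entryAt-lastVar l k acc D′ (rpBlock-paren r (lastVar l k) (rp ∷ D))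
  right : applyUpTo (λ i → E (size l + suc i)) (size r) ≡ nameFrom (lastVar l k) r
  right = trans (applyUpTo-cong (entryAt-skip-left l r k acc D) (size r)) (entryAt-paren r (lastVar l k) _ (rp ∷ D))

name≡nameFrom : ∀ t → name t ≡ nameFrom 0 t
name≡nameFrom t = trans (applyUpTo-cong nameAt≡entryAt (size t)) (entryAt-paren t 0 [] [])
  where
  nameAt≡entryAt : ∀ i → nameAt (paren t 0) (suc i) ≡ entryAt [] (paren t 0 ++ []) (suc i)
  nameAt≡entryAt i = trans (nameAt-readEntry (paren t 0) (suc i))
                           (cong (λ ts → entryAt [] ts (suc i)) (sym (++-identityʳ (paren t 0))))

nameFrom-shift : ∀ t k c → nameFrom (k + c) t ≡ map (_+ c) (nameFrom k t)
nameFrom-shift leaf       k c = refl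
nameFrom-shift (node l r) k c = begin
  nameFrom (k + c) l ++ suc (k + c) ∷ nameFrom (lastVar l (k + c)) r
    ≡⟨ cong (λ k′ → nameFrom (k + c) l ++ suc (k + c) ∷ nameFrom k′ r) (xy∙z≈xz∙y k c (suc (size l))) ⟩
  nameFrom (k + c) l ++ suc (k + c) ∷ nameFrom (lastVar l k + c) r
    ≡⟨ cong₂ (λ xs ys → xs ++ suc (k + c) ∷ ys) (nameFrom-shift l k c) (nameFrom-shift r (lastVar l k) c) ⟩
  map (_+ c) (nameFrom k l) ++ suc k + c ∷ map (_+ c) (nameFrom (lastVar l k) r)
    ≡⟨ map-++ (_+ c) (nameFrom k l) _ ⟨
  map (_+ c) (nameFrom k (node l r)) ∎

length-name : ∀ t → length (name t) ≡ size t
length-name t = length-applyUpTo _ (size t)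

name-node : ∀ l r → name (node l r) ≡ name l ∨ᵥ name r
name-node l r = begin
  name (node l r)                                                  ≡⟨ name≡nameFrom (node l r) ⟩
  nameFrom 0 l ++ 1 ∷ nameFrom (suc (size l)) r
    ≡⟨ cong₂ (λ xs ys → xs ++ 1 ∷ ys) (sym (name≡nameFrom l)) (nameFrom-shift r 0 (suc (size l))) ⟩
  name l ++ 1 ∷ map (_+ suc (size l)) (nameFrom 0 r)               ≡⟨ cong (λ ys → name l ++ 1 ∷ ys) (map-cong shift≗ (nameFrom 0 r)) ⟩
  name l ++ 1 ∷ map (λ x → x + length (name l) + 1) (nameFrom 0 r) ≡⟨ cong (λ ys → name l ++ 1 ∷ map _ ys) (name≡nameFrom r) ⟨
  name l ∨ᵥ name r                                                 ∎
  where
  shift≗ : ∀ x → x + suc (size l) ≡ x + length (name l) + 1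
  shift≗ x rewrite length-name l = trans (+-suc x (size l)) (sym (+-comm (x + size l) 1))

sumBy : {A : Set} → (A → ℤ) → List A → ℤ
sumBy f xs = sumℤ (map f xs)

onlyIf : {P : Set} → Dec P → ℤ → ℤ
onlyIf P? x = if does P? then x else 0ℤ

onlyIf-neg : ∀ {P : Set} (P? : Dec P) x → onlyIf P? (- x) ≡ - onlyIf P? x
onlyIf-neg P? x with does P?
... | true  = refl
... | false = refl

onlyIf-zero : ∀ {P : Set} (P? : Dec P) {x} → x ≡ 0ℤ → onlyIf P? x ≡ 0ℤ
onlyIf-zero P? refl with does P?
... | true  = refl
... | false = refl

onlyIf-interval : ∀ {P Q R : Set} (P? : Dec P) (Q? : Dec Q) (R? : Dec R) x → P → (R → Q) →
                  onlyIf (P? ×-dec (Q? ×-dec ¬? R?)) x ≡ onlyIf Q? x +ℤ - onlyIf R? x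
onlyIf-interval (no ¬p) _       _       x p _   = contradiction p ¬p
onlyIf-interval (yes _) (yes _) (yes _) x _ _   = sym (ℤ.+-inverseʳ x)
onlyIf-interval (yes _) (yes _) (no _)  x _ _   = sym (ℤ.+-identityʳ x)
onlyIf-interval (yes _) (no ¬q) (yes r) x _ r⇒q = contradiction (r⇒q r) ¬q
onlyIf-interval (yes _) (no _)  (no _)  x _ _   = refl

module _ {A : Set} where

  sumBy-++ : ∀ (f : A → ℤ) xs ys → sumBy f (xs ++ ys) ≡ sumBy f xs +ℤ sumBy f ys
  sumBy-++ f []       ys = sym (ℤ.+-identityˡ _)
  sumBy-++ f (x ∷ xs) ys = trans (cong (f x +ℤ_) (sumBy-++ f xs ys)) (sym (ℤ.+-assoc (f x) _ _))

  sumBy-map : ∀ {B : Set} (f : B → ℤ) (g : A → B) xs → sumBy f (map g xs) ≡ sumBy (λ a → f (g a)) xs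
  sumBy-map f g xs = cong sumℤ (sym (map-∘ xs))

  sumBy-+ : ∀ (f g : A → ℤ) xs → sumBy (λ a → f a +ℤ g a) xs ≡ sumBy f xs +ℤ sumBy g xs
  sumBy-+ f g []       = refl
  sumBy-+ f g (x ∷ xs) = trans (cong (f x +ℤ g x +ℤ_) (sumBy-+ f g xs)) (interchange (f x) (g x) _ _)

  sumBy-neg : ∀ (f : A → ℤ) xs → sumBy (λ a → - f a) xs ≡ - sumBy f xs
  sumBy-neg f []       = refl
  sumBy-neg f (x ∷ xs) = trans (cong (- f x +ℤ_) (sumBy-neg f xs)) (sym (ℤ.neg-distrib-+ (f x) _))

  sumBy-cong : ∀ {f g : A → ℤ} xs → (∀ {a} → a ∈ xs → f a ≡ g a) → sumBy f xs ≡ sumBy g xs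
  sumBy-cong []       f≗g = refl
  sumBy-cong (x ∷ xs) f≗g = cong₂ _+ℤ_ (f≗g (here refl)) (sumBy-cong xs (f≗g ∘ there))

  sumBy-zero : ∀ {f : A → ℤ} xs → (∀ {a} → a ∈ xs → f a ≡ 0ℤ) → sumBy f xs ≡ 0ℤ
  sumBy-zero []       f≗0 = refl
  sumBy-zero (x ∷ xs) f≗0 = cong₂ _+ℤ_ (f≗0 (here refl)) (sumBy-zero xs (f≗0 ∘ there))

  sumBy-filter : ∀ {P : A → Set} (P? : Decidable P) (f : A → ℤ) xs →
                 sumBy f (filter P? xs) ≡ sumBy (λ a → onlyIf (P? a) (f a)) xs
  sumBy-filter P? f []       = refl
  sumBy-filter P? f (x ∷ xs) with P? x
  ... | yes _ = cong (f x +ℤ_) (sumBy-filter P? f xs)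
  ... | no  _ = trans (sumBy-filter P? f xs) (sym (ℤ.+-identityˡ _))

  module _ (_≟ₐ_ : DecidableEquality A) where

    remove : A → List A → List A
    remove y = filter (λ a → ¬? (a ≟ₐ y))

    sumBy-remove : ∀ (f : A → ℤ) {y} xs → Unique xs → y ∈ xs → sumBy f xs ≡ f y +ℤ sumBy f (remove y xs)
    sumBy-remove f (x ∷ xs) (x∉xs ∷ _) (here refl) = cong (λ ys → f x +ℤ sumBy f ys) (sym (begin
      remove x (x ∷ xs) ≡⟨ filter-reject (λ a → ¬? (a ≟ₐ x)) (λ x≢x → x≢x refl) ⟩
      remove x xs       ≡⟨ filter-all (λ a → ¬? (a ≟ₐ x)) (All.map (λ x≢a a≡x → x≢a (sym a≡x)) x∉xs) ⟩
      xs                ∎))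
    sumBy-remove f {y} (x ∷ xs) (x∉xs ∷ u) (there y∈xs) = begin
      f x +ℤ sumBy f xs                     ≡⟨ cong (f x +ℤ_) (sumBy-remove f xs u y∈xs) ⟩
      f x +ℤ (f y +ℤ sumBy f (remove y xs)) ≡⟨ x∙yz≈y∙xz (f x) (f y) _ ⟩
      f y +ℤ sumBy f (x ∷ remove y xs)      ≡⟨ cong (λ ys → f y +ℤ sumBy f ys) (filter-accept (λ a → ¬? (a ≟ₐ y)) x≢y) ⟨
      f y +ℤ sumBy f (remove y (x ∷ xs))    ∎
      where x≢y = λ x≡y → All.lookup x∉xs y∈xs x≡y

    sumBy-support : ∀ (f : A → ℤ) xs ys → Unique xs → Unique ys → (∀ {a} → a ∈ ys → a ∈ xs) →
                    (∀ {a} → a ∈ xs → a ∉ ys → f a ≡ 0ℤ) → sumBy f xs ≡ sumBy f ys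
    sumBy-support f xs []       _   _            _     off = sumBy-zero xs (λ a∈xs → off a∈xs λ ())
    sumBy-support f xs (y ∷ ys) uxs (y∉ys ∷ uys) ys⊆xs off = begin
      sumBy f xs                   ≡⟨ sumBy-remove f xs uxs (ys⊆xs (here refl)) ⟩
      f y +ℤ sumBy f (remove y xs) ≡⟨ cong (f y +ℤ_) (sumBy-support f (remove y xs) ys (Unique.filter⁺ _ uxs) uys ys⊆rest off-rest) ⟩
      f y +ℤ sumBy f ys            ∎
      where
      ys⊆rest : ∀ {a} → a ∈ ys → a ∈ remove y xs
      ys⊆rest a∈ys = ∈-filter⁺ (λ a → ¬? (a ≟ₐ y)) (ys⊆xs (there a∈ys)) (λ a≡y → All.lookup y∉ys a∈ys (sym a≡y))
      off-rest : ∀ {a} → a ∈ remove y xs → a ∉ ys → f a ≡ 0ℤ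
      off-rest a∈rest a∉ys with ∈-filter⁻ (λ a → ¬? (a ≟ₐ y)) a∈rest
      ... | a∈xs , a≢y = off a∈xs λ { (here a≡y) → a≢y a≡y ; (there a∈ys) → a∉ys a∈ys }

    sumBy-onlyIf-≡ : ∀ (f : A → ℤ) {y} xs → Unique xs → y ∈ xs → sumBy (λ a → onlyIf (a ≟ₐ y) (f a)) xs ≡ f y
    sumBy-onlyIf-≡ f {y} xs uxs y∈xs = begin
      sumBy h xs ≡⟨ sumBy-support h xs (y ∷ []) uxs ([] ∷ []) (λ { (here refl) → y∈xs }) off ⟩
      h y +ℤ 0ℤ  ≡⟨ ℤ.+-identityʳ (h y) ⟩
      h y        ≡⟨ cong (λ b → if b then f y else 0ℤ) (dec-true (y ≟ₐ y) refl) ⟩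
      f y        ∎
      where
      h = λ a → onlyIf (a ≟ₐ y) (f a)
      off : ∀ {a} → a ∈ xs → a ∉ y ∷ [] → h a ≡ 0ℤ
      off {a} _ a∉[y] with a ≟ₐ y
      ... | yes refl = contradiction (here refl) a∉[y]
      ... | no _     = refl

-- The Möbius function as the solution of its recursion

≤ᵥ-refl : ∀ {v} → v ≤ᵥ v
≤ᵥ-refl = Pointwise.refl ≤-refl

≤ᵥ-antisym : ∀ {v w} → v ≤ᵥ w → w ≤ᵥ v → v ≡ w
≤ᵥ-antisym v≤w w≤v = Pointwise-≡⇒≡ (Pointwise.antisymmetric ≤-antisym v≤w w≤v)

<ᵥ-irrefl : ∀ {v} → ¬ v <ᵥ v
<ᵥ-irrefl (_ , v≢v) = v≢v refl

<ᵥ-trans : ∀ {u v w} → u <ᵥ v → v <ᵥ w → u <ᵥ w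
<ᵥ-trans (u≤v , _) (v≤w , v≢w) = Pointwise.transitive ≤-trans u≤v v≤w , λ { refl → v≢w (≤ᵥ-antisym v≤w u≤v) }

strictlyBelow : List (List ℕ) → List ℕ → ℕ
strictlyBelow es y = length (filter (_<ᵥ? y) es)

strictlyBelow-< : ∀ es {y z} → z ∈ es → z <ᵥ y → strictlyBelow es z < strictlyBelow es y
strictlyBelow-< es {y} {z} z∈es z<y =
  subst (_< strictlyBelow es y) (cong length (filter-filter-⊆ (_<ᵥ? z) (_<ᵥ? y) (λ a<z → <ᵥ-trans a<z z<y) es))
        (filter-notAll (_<ᵥ? z) _ (lose (∈-filter⁺ (_<ᵥ? y) z∈es z<y) <ᵥ-irrefl))

strictlyBelow-length : ∀ es {y} → y ∈ es → strictlyBelow es y < length es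
strictlyBelow-length es y∈es = filter-notAll (_<ᵥ? _) es (lose y∈es <ᵥ-irrefl)

mobF-unique : ∀ es x (g : List ℕ → ℤ) → g x ≡ 1ℤ →
              (∀ {y} → y ∈ es → x ≢ y → sumBy g (filter (λ z → (x ≤ᵥ? z) ×-dec (z <ᵥ? y)) es) ≡ - g y) →
              ∀ fuel {y} → y ∈ es → strictlyBelow es y < fuel → mobF fuel es x y ≡ g y
mobF-unique es x g gx≡1 recursion (suc fuel) {y} y∈es below<fuel with x ≟ᵥ y
... | yes refl = sym gx≡1
... | no x≢y   = begin
  - sumBy (mobF fuel es x) (filter Q? es) ≡⟨ cong -_ (sumBy-cong (filter Q? es) agrees) ⟩
  - sumBy g (filter Q? es)                ≡⟨ cong -_ (recursion y∈es x≢y) ⟩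
  - - g y                                 ≡⟨ ℤ.neg-involutive (g y) ⟩
  g y                                     ∎
  where
  Q? = λ z → (x ≤ᵥ? z) ×-dec (z <ᵥ? y)
  agrees : ∀ {z} → z ∈ filter Q? es → mobF fuel es x z ≡ g z
  agrees z∈ with ∈-filter⁻ Q? z∈
  ... | z∈es , _ , z<y =
    mobF-unique es x g gx≡1 recursion fuel z∈es (<-≤-trans (strictlyBelow-< es z∈es z<y) (s≤s⁻¹ below<fuel))

treesH-complete : ∀ t h → size t ≤ h → t ∈ treesH h
treesH-complete leaf       zero    _           = here refl
treesH-complete leaf       (suc h) _           = here refl
treesH-complete (node l r) (suc h) (s≤s l+r≤h) = there (∈-cartesianProductWith⁺ node
  (treesH-complete l h (≤-trans (m≤m+n (size l) (size r)) l+r≤h))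
  (treesH-complete r h (≤-trans (m≤n+m (size r) (size l)) l+r≤h)))

∈-names⁺ : ∀ {n v} → IsName n v → v ∈ names n
∈-names⁺ {n} (t , t∈Yn , refl) = ∈-deduplicate⁺ _≟ᵥ_
  (∈-map⁺ name (∈-filter⁺ (λ t → size t ≟ n) (treesH-complete t n (≤-reflexive t∈Yn)) t∈Yn))

∈-names⁻ : ∀ n {v} → v ∈ names n → IsName n v
∈-names⁻ n v∈names with ∈-map⁻ name (∈-deduplicate⁻ _≟ᵥ_ (map name (allTrees n)) v∈names)
... | t , t∈allTrees , refl = t , proj₂ (∈-filter⁻ (λ t → size t ≟ n) {xs = treesH n} t∈allTrees) , refl

names-unique : ∀ n → Unique (names n)
names-unique n = deduplicate-! (map name (allTrees n))

IsName-length : ∀ {n v} → IsName n v → length v ≡ n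
IsName-length (t , t∈Yn , refl) = trans (length-name t) t∈Yn

name-positive : ∀ t → All (1 ≤_) (name t)
name-positive leaf       = []
name-positive (node l r) rewrite name-node l r =
  ++⁺ (name-positive l) (s≤s z≤n ∷ map⁺ (All.map (λ {x} _ → m≤n+m 1 (x + length (name l))) (name-positive r)))

name-head : ∀ l r → ∃[ w ] name (node l r) ≡ 1 ∷ w
name-head leaf         r = _ , name-node leaf r
name-head (node l₁ l₂) r with name-head l₁ l₂
... | w , eq = _ , trans (name-node (node l₁ l₂) r) (cong (_∨ᵥ name r) eq)

names-head : ∀ n {v} → v ∈ names (suc n) → ∃[ w ] v ≡ 1 ∷ w
names-head n v∈names with ∈-names⁻ (suc n) v∈names
... | node l r , _ , refl = name-head l r

names-positive : ∀ n {v} → v ∈ names n → All (1 ≤_) v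
names-positive n v∈names with ∈-names⁻ n v∈names
... | t , _ , refl = name-positive t

ones-≤ᵥ : ∀ {v} → All (1 ≤_) v → replicate (length v) 1 ≤ᵥ v
ones-≤ᵥ []           = []
ones-≤ᵥ (1≤a ∷ 1≤as) = 1≤a ∷ ones-≤ᵥ 1≤as

names-≥-ones : ∀ n {v} → v ∈ names n → replicate n 1 ≤ᵥ v
names-≥-ones n {v} v∈names =
  subst (λ m → replicate m 1 ≤ᵥ v) (IsName-length (∈-names⁻ n v∈names)) (ones-≤ᵥ (names-positive n v∈names))

-- The closed form of M

mobiusFormula : ℕ → List ℕ → ℤ
mobiusFormula k []       = 1ℤ
mobiusFormula k (a ∷ as) with a ≟ 1 | a ≟ k
... | yes _ | _     = mobiusFormula (suc k) as
... | no _  | yes _ = - mobiusFormula (suc k) as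
... | no _  | no _  = 0ℤ

mobiusFormula-ones : ∀ k n → mobiusFormula k (replicate n 1) ≡ 1ℤ
mobiusFormula-ones k zero    = refl
mobiusFormula-ones k (suc n) = mobiusFormula-ones (suc k) n

mobiusFormula-diagonal : ∀ {k} as → 2 ≤ k → mobiusFormula k (k ∷ as) ≡ - mobiusFormula (suc k) as
mobiusFormula-diagonal {k} as 2≤k with k ≟ 1 | k ≟ k
... | yes refl | _      = contradiction 2≤k (λ { (s≤s ()) })
... | no _     | yes _  = refl
... | no _     | no k≢k = contradiction refl k≢k

mobiusFormula-other : ∀ {k a} as → a ≢ 1 → a ≢ k → mobiusFormula k (a ∷ as) ≡ 0ℤ
mobiusFormula-other {k} {a} as a≢1 a≢k with a ≟ 1 | a ≟ k
... | yes a≡1 | _       = contradiction a≡1 a≢1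
... | no _    | yes a≡k = contradiction a≡k a≢k
... | no _    | no _    = refl

mobiusFormula-++ : ∀ k v w → mobiusFormula k (v ++ w) ≡ mobiusFormula k v * mobiusFormula (k + length v) w
mobiusFormula-++ k []      w rewrite +-identityʳ k = sym (ℤ.*-identityˡ _)
mobiusFormula-++ k (a ∷ v) w rewrite +-suc k (length v) with a ≟ 1 | a ≟ k
... | yes _ | _     = mobiusFormula-++ (suc k) v w
... | no _  | yes _ = trans (cong -_ (mobiusFormula-++ (suc k) v w)) (ℤ.neg-distribˡ-* (mobiusFormula (suc k) v) _)
... | no _  | no _  = refl

-- The lists of length n whose entry at each position p = k, k + 1, … is 1 or p.
choices : ℕ → ℕ → List (List ℕ)
choices k zero    = [ [] ]
choices k (suc n) = map (1 ∷_) (choices (suc k) n) ++ map (k ∷_) (choices (suc k) n)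

choices-unique : ∀ {k} n → 2 ≤ k → Unique (choices k n)
choices-unique         zero    _   = [] ∷ []
choices-unique {k} (suc n) 2≤k =
  Unique.++⁺ (Unique.map⁺ ∷-injectiveʳ rest) (Unique.map⁺ ∷-injectiveʳ rest) disjoint
  where
  rest = choices-unique n (m≤n⇒m≤1+n 2≤k)
  disjoint : ∀ {z} → ¬ (z ∈ map (1 ∷_) (choices (suc k) n) × z ∈ map (k ∷_) (choices (suc k) n))
  disjoint (z∈₁ , z∈ₖ) with ∈-map⁻ (1 ∷_) z∈₁ | ∈-map⁻ (k ∷_) z∈ₖ
  ... | _ , _ , refl | _ , _ , eq = contradiction (∷-injectiveˡ eq) (λ 1≡k → <-irrefl 1≡k 2≤k)

choices-complete : ∀ k z → mobiusFormula k z ≢ 0ℤ → z ∈ choices k (length z)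
choices-complete k []      _ = here refl
choices-complete k (a ∷ z) nonzero with a ≟ 1 | a ≟ k
... | yes refl | _        = ∈-++⁺ˡ (∈-map⁺ (1 ∷_) (choices-complete (suc k) z nonzero))
... | no _     | yes refl = ∈-++⁺ʳ _ (∈-map⁺ (a ∷_) (choices-complete (suc k) z (λ z≡0 → nonzero (cong -_ z≡0))))
... | no _     | no _     = contradiction refl nonzero

extendRight : Tree → Tree
extendRight leaf       = node leaf leaf
extendRight (node l r) = node l (extendRight r)

size-extendRight : ∀ t → size (extendRight t) ≡ suc (size t)
size-extendRight leaf       = refl
size-extendRight (node l r) = cong suc (trans (cong (size l +_) (size-extendRight r)) (+-suc (size l) (size r)))

name-extendRight : ∀ t → name (extendRight t) ≡ name t ++ [ suc (size t) ]
name-extendRight leaf       = name-node leaf leaf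
name-extendRight (node l r) = begin
  name (node l (extendRight r))                                ≡⟨ name-node l (extendRight r) ⟩
  name l ++ 1 ∷ map sh (name (extendRight r))                  ≡⟨ cong (λ v → name l ++ 1 ∷ map sh v) (name-extendRight r) ⟩
  name l ++ 1 ∷ map sh (name r ++ [ suc (size r) ])            ≡⟨ cong (λ v → name l ++ 1 ∷ v) (map-++ sh (name r) _) ⟩
  name l ++ 1 ∷ map sh (name r) ++ [ sh (suc (size r)) ]       ≡⟨ cong (λ x → name l ++ 1 ∷ map sh (name r) ++ [ x ]) last≡ ⟩
  name l ++ (1 ∷ map sh (name r)) ++ [ suc (size (node l r)) ] ≡⟨ ++-assoc (name l) _ _ ⟨
  (name l ∨ᵥ name r) ++ [ suc (size (node l r)) ]              ≡⟨ cong (_++ [ suc (size (node l r)) ]) (name-node l r) ⟨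
  name (node l r) ++ [ suc (size (node l r)) ]                 ∎
  where
  sh = λ x → x + length (name l) + 1
  last≡ : sh (suc (size r)) ≡ suc (size (node l r))
  last≡ rewrite length-name l = cong suc (trans (+-comm (size r + size l) 1) (cong suc (+-comm (size r) (size l))))

IsName-snoc : ∀ {s n c z} t t′ → name t′ ≡ name t ++ [ c ] →
              IsName (suc s + n) (name t′ ++ z) → IsName (s + suc n) (name t ++ c ∷ z)
IsName-snoc {s} {n} {c} {z} t t′ name≡ =
  subst₂ IsName (sym (+-suc s n)) (trans (cong (_++ z) name≡) (++-assoc (name t) [ c ] z))

choices-names : ∀ {s} t → size t ≡ s → ∀ {n z} → z ∈ choices (suc s) n → IsName (s + n) (name t ++ z)
choices-names t refl {zero}  (here refl) = t , sym (+-identityʳ (size t)) , sym (++-identityʳ (name t))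
choices-names t refl {suc n} z∈ with ∈-++⁻ (map (1 ∷_) (choices (suc (suc (size t))) n)) z∈
... | inj₁ z∈₁ with ∈-map⁻ (1 ∷_) z∈₁
...   | z , z∈choices , refl =
  IsName-snoc t (node t leaf) (name-node t leaf) (choices-names (node t leaf) (cong suc (+-identityʳ (size t))) z∈choices)
choices-names t refl {suc n} z∈ | inj₂ z∈ₖ with ∈-map⁻ (suc (size t) ∷_) z∈ₖ
...   | z , z∈choices , refl =
  IsName-snoc t (extendRight t) (name-extendRight t) (choices-names (extendRight t) (size-extendRight t) z∈choices)

-- Some entry a sits at a position p ≥ 2 with p ≤ a, where the first entry has position k.
data ReachesDiagonal : ℕ → List ℕ → Set where
  here  : ∀ {k a as} → 2 ≤ k → k ≤ a → ReachesDiagonal k (a ∷ as)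
  there : ∀ {k a as} → ReachesDiagonal (suc k) as → ReachesDiagonal k (a ∷ as)

reaches-++ˡ : ∀ {k v} w → ReachesDiagonal k v → ReachesDiagonal k (v ++ w)
reaches-++ˡ w (here 2≤k k≤a) = here 2≤k k≤a
reaches-++ˡ w (there r)      = there (reaches-++ˡ w r)

reaches-++ʳ : ∀ {k} v {w} → ReachesDiagonal (k + length v) w → ReachesDiagonal k (v ++ w)
reaches-++ʳ {k} []          r rewrite +-identityʳ k = r
reaches-++ʳ {k} (a ∷ v) {w} r = there (reaches-++ʳ v (subst (λ j → ReachesDiagonal j w) (+-suc k (length v)) r))

reaches-tail : ∀ {w} → ReachesDiagonal 1 (1 ∷ w) → ReachesDiagonal 2 w
reaches-tail (here (s≤s ()) _)
reaches-tail (there r) = r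

name-reachesDiagonal : ∀ t → name t ≢ replicate (size t) 1 → ReachesDiagonal 1 (name t)
name-reachesDiagonal leaf                notOnes = contradiction refl notOnes
name-reachesDiagonal (node l leaf)       notOnes rewrite name-node l leaf | +-identityʳ (size l) =
  reaches-++ˡ [ 1 ] (name-reachesDiagonal l λ ones →
    notOnes (trans (cong (_++ [ 1 ]) ones) (trans (replicate-++-∷ (size l) 1 []) (cong (1 ∷_) (++-identityʳ _)))))
name-reachesDiagonal (node l (node a b)) notOnes with name-head a b
... | w , eq = subst (ReachesDiagonal 1) (sym (trans (name-node l (node a b)) (cong (name l ∨ᵥ_) eq)))
  (reaches-++ʳ (name l) (there (here (s≤s (s≤s z≤n)) (≤-reflexive (+-comm 1 (1 + length (name l)))))))

names-reachesDiagonal : ∀ n {v} → v ∈ names n → replicate n 1 ≢ v → ReachesDiagonal 1 v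
names-reachesDiagonal n v∈names notOnes with ∈-names⁻ n v∈names
... | t , refl , refl = name-reachesDiagonal t (λ ones → notOnes (sym ones))

onlyIf-∷-≤ : ∀ {c a} z as (x : ℤ) → c ≤ a → onlyIf ((c ∷ z) ≤ᵥ? (a ∷ as)) x ≡ onlyIf (z ≤ᵥ? as) x
onlyIf-∷-≤ {c} {a} z as x c≤a rewrite dec-true (c ≤? a) c≤a = refl

onlyIf-∷-≰ : ∀ {c a} z as (x : ℤ) → ¬ c ≤ a → onlyIf ((c ∷ z) ≤ᵥ? (a ∷ as)) x ≡ 0ℤ
onlyIf-∷-≰ {c} {a} z as x c≰a rewrite dec-false (c ≤? a) c≰a = refl

choiceSum : ℕ → List ℕ → ℤ
choiceSum k y = sumBy (λ z → onlyIf (z ≤ᵥ? y) (mobiusFormula k z)) (choices k (length y))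

choiceSum-∷ : ∀ k {a} as → 1 ≤ a →
  choiceSum k (a ∷ as)
    ≡ choiceSum (suc k) as +ℤ sumBy (λ z → onlyIf ((k ∷ z) ≤ᵥ? (a ∷ as)) (mobiusFormula k (k ∷ z))) (choices (suc k) (length as))
choiceSum-∷ k {a} as 1≤a = begin
  sumBy f (map (1 ∷_) zs ++ map (k ∷_) zs)                 ≡⟨ sumBy-++ f (map (1 ∷_) zs) _ ⟩
  sumBy f (map (1 ∷_) zs) +ℤ sumBy f (map (k ∷_) zs)       ≡⟨ cong₂ _+ℤ_ (sumBy-map f (1 ∷_) zs) (sumBy-map f (k ∷_) zs) ⟩
  sumBy (λ z → f (1 ∷ z)) zs +ℤ sumBy (λ z → f (k ∷ z)) zs
    ≡⟨ cong (_+ℤ sumBy (λ z → f (k ∷ z)) zs) (sumBy-cong zs (λ {z} _ → onlyIf-∷-≤ z as _ 1≤a)) ⟩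
  choiceSum (suc k) as +ℤ sumBy (λ z → f (k ∷ z)) zs       ∎
  where
  zs = choices (suc k) (length as)
  f = λ z → onlyIf (z ≤ᵥ? (a ∷ as)) (mobiusFormula k z)

choiceSum-cancel : ∀ {k a} as → 2 ≤ k → 1 ≤ a → k ≤ a → choiceSum k (a ∷ as) ≡ 0ℤ
choiceSum-cancel {k} {a} as 2≤k 1≤a k≤a = begin
  choiceSum k (a ∷ as)                                                                   ≡⟨ choiceSum-∷ k as 1≤a ⟩
  S +ℤ sumBy (λ z → onlyIf ((k ∷ z) ≤ᵥ? (a ∷ as)) (mobiusFormula k (k ∷ z))) zs         ≡⟨ cong (S +ℤ_) (sumBy-cong zs negated) ⟩
  S +ℤ sumBy (λ z → - onlyIf (z ≤ᵥ? as) (mobiusFormula (suc k) z)) zs                   ≡⟨ cong (S +ℤ_) (sumBy-neg _ zs) ⟩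
  S +ℤ - S                                                                               ≡⟨ ℤ.+-inverseʳ S ⟩
  0ℤ                                                                                     ∎
  where
  zs = choices (suc k) (length as)
  S = choiceSum (suc k) as
  negated : ∀ {z} → z ∈ zs →
            onlyIf ((k ∷ z) ≤ᵥ? (a ∷ as)) (mobiusFormula k (k ∷ z)) ≡ - onlyIf (z ≤ᵥ? as) (mobiusFormula (suc k) z)
  negated {z} _ = begin
    onlyIf ((k ∷ z) ≤ᵥ? (a ∷ as)) (mobiusFormula k (k ∷ z)) ≡⟨ onlyIf-∷-≤ z as _ k≤a ⟩
    onlyIf (z ≤ᵥ? as) (mobiusFormula k (k ∷ z))             ≡⟨ cong (onlyIf (z ≤ᵥ? as)) (mobiusFormula-diagonal z 2≤k) ⟩
    onlyIf (z ≤ᵥ? as) (- mobiusFormula (suc k) z)           ≡⟨ onlyIf-neg (z ≤ᵥ? as) _ ⟩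
    - onlyIf (z ≤ᵥ? as) (mobiusFormula (suc k) z)           ∎

choiceSum-skip : ∀ {k a} as → 1 ≤ a → ¬ k ≤ a → choiceSum k (a ∷ as) ≡ choiceSum (suc k) as
choiceSum-skip {k} {a} as 1≤a k≰a = begin
  choiceSum k (a ∷ as)                                                                     ≡⟨ choiceSum-∷ k as 1≤a ⟩
  choiceSum (suc k) as +ℤ sumBy (λ z → onlyIf ((k ∷ z) ≤ᵥ? (a ∷ as)) (mobiusFormula k (k ∷ z))) zs
    ≡⟨ cong (choiceSum (suc k) as +ℤ_) (sumBy-zero zs λ {z} _ → onlyIf-∷-≰ z as _ k≰a) ⟩
  choiceSum (suc k) as +ℤ 0ℤ                                                               ≡⟨ ℤ.+-identityʳ _ ⟩
  choiceSum (suc k) as                                                                     ∎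
  where zs = choices (suc k) (length as)

choiceSum-vanishes : ∀ {k y} → 2 ≤ k → All (1 ≤_) y → ReachesDiagonal k y → choiceSum k y ≡ 0ℤ
choiceSum-vanishes {y = _ ∷ as} 2≤k (1≤a ∷ _) (here _ k≤a) = choiceSum-cancel as 2≤k 1≤a k≤a
choiceSum-vanishes {k} {a ∷ as} 2≤k (1≤a ∷ 1≤as) (there r) with k ≤? a
... | yes k≤a = choiceSum-cancel as 2≤k 1≤a k≤a
... | no  k≰a = trans (choiceSum-skip as 1≤a k≰a) (choiceSum-vanishes (m≤n⇒m≤1+n 2≤k) 1≤as r)

mobiusFormula-sum-≤ : ∀ N {y} → y ∈ names (suc N) → replicate (suc N) 1 ≢ y →
                      sumBy (λ z → onlyIf (z ≤ᵥ? y) (mobiusFormula 1 z)) (names (suc N)) ≡ 0ℤ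
mobiusFormula-sum-≤ N {y} y∈names notOnes with names-head N y∈names
... | w , refl = begin
  sumBy f (names (suc N))               ≡⟨ sumBy-support _≟ᵥ_ f (names (suc N)) Z (names-unique (suc N)) Z-unique Z⊆names off-Z ⟩
  sumBy f Z                             ≡⟨ sumBy-map f (1 ∷_) (choices 2 N) ⟩
  sumBy (λ z → f (1 ∷ z)) (choices 2 N) ≡⟨ cong (λ n → sumBy (λ z → f (1 ∷ z)) (choices 2 n)) (length-tail y∈names) ⟨
  choiceSum 2 w                         ≡⟨ choiceSum-vanishes ≤-refl positive reaches ⟩
  0ℤ                                    ∎
  where
  f = λ z → onlyIf (z ≤ᵥ? (1 ∷ w)) (mobiusFormula 1 z)
  Z = map (1 ∷_) (choices 2 N)
  length-tail : ∀ {v} → 1 ∷ v ∈ names (suc N) → length v ≡ N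
  length-tail v∈names = suc-injective (IsName-length (∈-names⁻ (suc N) v∈names))
  positive : All (1 ≤_) w
  positive with names-positive (suc N) y∈names
  ... | _ ∷ 1≤w = 1≤w
  reaches : ReachesDiagonal 2 w
  reaches = reaches-tail (names-reachesDiagonal (suc N) y∈names notOnes)
  Z-unique = Unique.map⁺ ∷-injectiveʳ (choices-unique N ≤-refl)
  Z⊆names : ∀ {a} → a ∈ Z → a ∈ names (suc N)
  Z⊆names a∈Z with ∈-map⁻ (1 ∷_) a∈Z
  ... | z , z∈choices , refl = ∈-names⁺ (choices-names (node leaf leaf) refl {N} z∈choices)
  off-Z : ∀ {a} → a ∈ names (suc N) → a ∉ Z → f a ≡ 0ℤ
  off-Z a∈names a∉Z with names-head N a∈names
  ... | v , refl with mobiusFormula 2 v ≟ℤ 0ℤ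
  ...   | yes vanishes = onlyIf-zero ((1 ∷ v) ≤ᵥ? (1 ∷ w)) vanishes
  ...   | no nonzero   =
    contradiction (∈-map⁺ (1 ∷_) (subst (λ n → v ∈ choices 2 n) (length-tail a∈names) (choices-complete 2 v nonzero))) a∉Z

M≡mobiusFormula : ∀ N {y} → y ∈ names (suc N) → M (suc N) y ≡ mobiusFormula 1 y
M≡mobiusFormula N y∈names =
  mobF-unique es ones g (mobiusFormula-ones 1 (suc N)) recursion (length es) y∈names (strictlyBelow-length es y∈names)
  where
  es = names (suc N)
  ones = replicate (suc N) 1
  g = mobiusFormula 1
  recursion : ∀ {y} → y ∈ es → ones ≢ y → sumBy g (filter (λ z → (ones ≤ᵥ? z) ×-dec (z <ᵥ? y)) es) ≡ - g y
  recursion {y} y∈es ones≢y = begin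
    sumBy g (filter Q? es)                                                             ≡⟨ sumBy-filter Q? g es ⟩
    sumBy (λ z → onlyIf (Q? z) (g z)) es                                               ≡⟨ sumBy-cong es interval ⟩
    sumBy (λ z → onlyIf (z ≤ᵥ? y) (g z) +ℤ - onlyIf (z ≟ᵥ y) (g z)) es                 ≡⟨ sumBy-+ _ _ es ⟩
    sumBy (λ z → onlyIf (z ≤ᵥ? y) (g z)) es +ℤ sumBy (λ z → - onlyIf (z ≟ᵥ y) (g z)) es
      ≡⟨ cong₂ _+ℤ_ (mobiusFormula-sum-≤ N y∈es ones≢y) (sumBy-neg _ es) ⟩
    0ℤ +ℤ - sumBy (λ z → onlyIf (z ≟ᵥ y) (g z)) es
      ≡⟨ cong (λ s → 0ℤ +ℤ - s) (sumBy-onlyIf-≡ _≟ᵥ_ g es (names-unique (suc N)) y∈es) ⟩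
    0ℤ +ℤ - g y                                                                        ≡⟨ ℤ.+-identityˡ (- g y) ⟩
    - g y                                                                              ∎
    where
    Q? = λ z → (ones ≤ᵥ? z) ×-dec (z <ᵥ? y)
    interval : ∀ {z} → z ∈ es → onlyIf (Q? z) (g z) ≡ onlyIf (z ≤ᵥ? y) (g z) +ℤ - onlyIf (z ≟ᵥ y) (g z)
    interval {z} z∈es =
      onlyIf-interval (ones ≤ᵥ? z) (z ≤ᵥ? y) (z ≟ᵥ y) (g z) (names-≥-ones (suc N) z∈es) λ { refl → ≤ᵥ-refl }

-- Grafting

diagonalSign : ℕ → List ℕ → ℤ
diagonalSign j []       = 1ℤ
diagonalSign j (a ∷ as) with a ≟ j
... | yes _ = - diagonalSign (suc j) as
... | no  _ = 0ℤ

mobiusFormula-shift : ∀ j {L} w → 1 ≤ L → mobiusFormula (suc (j + L)) (map (λ x → x + L + 1) w) ≡ diagonalSign j w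
mobiusFormula-shift j {L} []      _   = refl
mobiusFormula-shift j {L} (a ∷ w) 1≤L with a ≟ j
... | yes refl = begin
  mobiusFormula (suc (a + L)) (a + L + 1 ∷ shifted)    ≡⟨ cong (λ b → mobiusFormula (suc (a + L)) (b ∷ shifted)) (+-comm (a + L) 1) ⟩
  mobiusFormula (suc (a + L)) (suc (a + L) ∷ shifted) ≡⟨ mobiusFormula-diagonal shifted (s≤s (≤-trans 1≤L (m≤n+m L a))) ⟩
  - mobiusFormula (suc (suc a + L)) shifted            ≡⟨ cong -_ (mobiusFormula-shift (suc a) w 1≤L) ⟩
  - diagonalSign (suc a) w                             ∎
  where shifted = map (λ x → x + L + 1) w
... | no a≢j = mobiusFormula-other _ shifted≢1 shifted≢position
  where
  shifted≢1 : a + L + 1 ≢ 1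
  shifted≢1 eq = contradiction (m+n≡0⇒n≡0 a (+-cancelʳ-≡ 1 (a + L) 0 eq)) (λ L≡0 → <-irrefl (sym L≡0) 1≤L)
  shifted≢position : a + L + 1 ≢ suc (j + L)
  shifted≢position eq = a≢j (+-cancelʳ-≡ L a j (suc-injective (trans (+-comm 1 (a + L)) eq)))

diagonalSign-iterate : ∀ j m → diagonalSign j (iterate suc j m) ≡ -1ℤ ^ m
diagonalSign-iterate j zero    = refl
diagonalSign-iterate j (suc m) with j ≟ j
... | yes _  = trans (cong -_ (diagonalSign-iterate (suc j) m)) (sym (ℤ.-1*i≡-i _))
... | no j≢j = contradiction refl j≢j

diagonalSign-off : ∀ j w → w ≢ iterate suc j (length w) → diagonalSign j w ≡ 0ℤ
diagonalSign-off j []      w≢ = contradiction refl w≢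
diagonalSign-off j (a ∷ w) w≢ with a ≟ j
... | yes refl = cong -_ (diagonalSign-off (suc a) w (λ eq → w≢ (cong (a ∷_) eq)))
... | no  _    = refl

idName-iterate : ∀ m → idName m ≡ iterate suc 1 m
idName-iterate m = applyUpTo-iterate suc m (λ _ → refl)

M-graft : ∀ n m π τ → Y (suc n) π → Y m τ →
          M (suc n + m + 1) (name (graft π τ)) ≡ M (suc n) (name π) * diagonalSign 1 (name τ)
M-graft n m π τ π∈Y τ∈Y = begin
  M (suc n + m + 1) (name (node π τ))
    ≡⟨ M≡mobiusFormula (n + m + 1) (∈-names⁺ (node π τ , size-graft , refl)) ⟩
  mobiusFormula 1 (name (node π τ))
    ≡⟨ cong (mobiusFormula 1) (name-node π τ) ⟩
  mobiusFormula 1 (name π ∨ᵥ name τ)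
    ≡⟨ mobiusFormula-++ 1 (name π) _ ⟩
  mobiusFormula 1 (name π) * mobiusFormula (suc (1 + length (name π))) (map (λ x → x + length (name π) + 1) (name τ))
    ≡⟨ cong₂ _*_ (sym (M≡mobiusFormula n (∈-names⁺ (π , π∈Y , refl)))) (mobiusFormula-shift 1 (name τ) 1≤|π|) ⟩
  M (suc n) (name π) * diagonalSign 1 (name τ) ∎
  where
  size-graft : size (node π τ) ≡ suc n + m + 1
  size-graft rewrite π∈Y | τ∈Y = cong suc (+-comm 1 (n + m))
  1≤|π| : 1 ≤ length (name π)
  1≤|π| rewrite length-name π | π∈Y = s≤s z≤n

∨ᵥ-mono : ∀ {v w u z} → length v ≡ length w → v ≤ᵥ w → u ≤ᵥ z → (v ∨ᵥ u) ≤ᵥ (w ∨ᵥ z)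
∨ᵥ-mono {w = w} len≡ v≤w u≤z rewrite len≡ =
  Pointwise.++⁺ v≤w (≤-refl ∷ Pointwise.map⁺ _ _ (Pointwise.map (λ x≤y → +-monoˡ-≤ 1 (+-monoˡ-≤ (length w) x≤y)) u≤z))

∨ᵥ-≤-split : ∀ {v w u z} → length v ≡ length w → (v ∨ᵥ u) ≤ᵥ (w ∨ᵥ z) → v ≤ᵥ w × u ≤ᵥ z
∨ᵥ-≤-split {v} {w} {u} {z} len≡ v∨u≤w∨z rewrite len≡
  with Pointwise-++⁻ {a = v} {w} {c = 1 ∷ map (λ x → x + length w + 1) u} {1 ∷ map (λ x → x + length w + 1) z} len≡ v∨u≤w∨z
... | v≤w , _ ∷ shifted =
  v≤w , Pointwise.map (λ {x} {y} le → +-cancelʳ-≤ (length w) x y (+-cancelʳ-≤ 1 _ _ le)) (Pointwise.map⁻ _ _ shifted)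

∨ᵥ-injective : ∀ {v w u z} → length v ≡ length w → v ∨ᵥ u ≡ w ∨ᵥ z → v ≡ w × u ≡ z
∨ᵥ-injective {v} {w} {u} {z} len≡ eq
  with ∨ᵥ-≤-split len≡ (subst ((v ∨ᵥ u) ≤ᵥ_) eq ≤ᵥ-refl) | ∨ᵥ-≤-split (sym len≡) (subst (_≤ᵥ (v ∨ᵥ u)) eq ≤ᵥ-refl)
... | v≤w , u≤z | w≤v , z≤u = ≤ᵥ-antisym v≤w w≤v , ≤ᵥ-antisym u≤z z≤u

∨ᵥ-<-⇔ : ∀ {v w u z} → length v ≡ length w → ((v ≤ᵥ w × u <ᵥ z) ⊎ (v <ᵥ w × u ≤ᵥ z)) ⇔ ((v ∨ᵥ u) <ᵥ (w ∨ᵥ z))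
∨ᵥ-<-⇔ {v} {w} {u} {z} len≡ = mk⇔ to from
  where
  to : (v ≤ᵥ w × u <ᵥ z) ⊎ (v <ᵥ w × u ≤ᵥ z) → (v ∨ᵥ u) <ᵥ (w ∨ᵥ z)
  to (inj₁ (v≤w , u≤z , u≢z))   = ∨ᵥ-mono len≡ v≤w u≤z , λ eq → u≢z (proj₂ (∨ᵥ-injective len≡ eq))
  to (inj₂ ((v≤w , v≢w) , u≤z)) = ∨ᵥ-mono len≡ v≤w u≤z , λ eq → v≢w (proj₁ (∨ᵥ-injective len≡ eq))
  from : (v ∨ᵥ u) <ᵥ (w ∨ᵥ z) → (v ≤ᵥ w × u <ᵥ z) ⊎ (v <ᵥ w × u ≤ᵥ z)
  from (le , v∨u≢w∨z) with ∨ᵥ-≤-split len≡ le | v ≟ᵥ w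
  ... | v≤w , u≤z | yes refl = inj₁ (v≤w , u≤z , λ { refl → v∨u≢w∨z refl })
  ... | v≤w , u≤z | no v≢w   = inj₂ ((v≤w , v≢w) , u≤z)

M-graft-diagonal : ∀ n m π τ → Y (suc n) π → Y m τ → name τ ≡ idName m →
                   M (suc n + m + 1) (name (graft π τ)) ≡ (-1ℤ ^ m) * M (suc n) (name π)
M-graft-diagonal n m π τ π∈Y τ∈Y τ≡id = begin
  M (suc n + m + 1) (name (graft π τ))  ≡⟨ M-graft n m π τ π∈Y τ∈Y ⟩
  Mπ * diagonalSign 1 (name τ)          ≡⟨ cong (λ w → Mπ * diagonalSign 1 w) (trans τ≡id (idName-iterate m)) ⟩
  Mπ * diagonalSign 1 (iterate suc 1 m) ≡⟨ cong (Mπ *_) (diagonalSign-iterate 1 m) ⟩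
  Mπ * (-1ℤ ^ m)                        ≡⟨ ℤ.*-comm Mπ _ ⟩
  (-1ℤ ^ m) * Mπ                        ∎
  where Mπ = M (suc n) (name π)

M-graft-off-diagonal : ∀ n m π τ → Y (suc n) π → Y m τ → ¬ (name τ ≡ idName m) →
                       M (suc n + m + 1) (name (graft π τ)) ≡ 0ℤ
M-graft-off-diagonal n m π τ π∈Y τ∈Y τ≢id = begin
  M (suc n + m + 1) (name (graft π τ)) ≡⟨ M-graft n m π τ π∈Y τ∈Y ⟩
  Mπ * diagonalSign 1 (name τ)         ≡⟨ cong (Mπ *_) (diagonalSign-off 1 (name τ) τ≢iterate) ⟩
  Mπ * 0ℤ                              ≡⟨ ℤ.*-zeroʳ Mπ ⟩
  0ℤ                                   ∎
  where
  Mπ = M (suc n) (name π)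
  τ≢iterate : name τ ≢ iterate suc 1 (length (name τ))
  τ≢iterate eq = τ≢id (trans eq (trans (cong (iterate suc 1) (IsName-length (τ , τ∈Y , refl))) (sym (idName-iterate m))))

-- The hypothesis 1 ≤ m is unused: the statement also holds for τ = leaf.
proposition3p2 : (n m : ℕ) → 1 ≤ n → 1 ≤ m → (π τ : Tree) → Y n π → Y m τ →
      (name (graft π τ) ≡ name π ∨ᵥ name τ)
    × ((name τ ≡ idName m → M (n + m + 1) (name (graft π τ)) ≡ (-1ℤ ^ m) * M n (name π))
      × (¬ (name τ ≡ idName m) → M (n + m + 1) (name (graft π τ)) ≡ 0ℤ))
    × ((v w u z : List ℕ) → IsName n v → IsName n w → IsName m u → IsName m z →
        (((v ≤ᵥ w × u <ᵥ z) ⊎ (v <ᵥ w × u ≤ᵥ z)) ⇔ ((v ∨ᵥ u) <ᵥ (w ∨ᵥ z))))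
proposition3p2 (suc n) m _ _ π τ π∈Y τ∈Y =
    name-node π τ
  , (M-graft-diagonal n m π τ π∈Y τ∈Y , M-graft-off-diagonal n m π τ π∈Y τ∈Y)
  , λ v w u z v∈Yn w∈Yn _ _ → ∨ᵥ-<-⇔ (trans (IsName-length v∈Yn) (sym (IsName-length w∈Yn)))
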